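{- Let $G=(V,E)$ be a finite, simple, connected graph with $|V|\ge2$ and $\mathrm{QEC}(G)<-1/2$. Then the clique graph $\Gamma(G)$ is a tree.
   Context: For a finite connected graph $G=(V,E)$ with $|V|\ge2$, let $D=[d_G(x,y)]_{x,y\in V}$ be its distance matrix ($d_G$ the graph distance). The quadratic embedding constant is $\mathrm{QEC}(G)=\max\{\langle f,Df\rangle : f\in\mathbb{R}^V,\ \langle f,f\rangle=1,\ \langle \mathbf{1},f\rangle=0\}$, where $\mathbf{1}$ is the all-ones vector. A clique is a nonempty vertex subset inducing a complete graph; a maximal clique is one maximal under inclusion. The clique graph $\Gamma(G)$ has as vertices the maximal cliques of $G$, with two maximal cliques $H_1,H_2$ adjacent iff $H_1\neq H_2$ and $H_1\cap H_2\neq\emptyset$. -}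

module Defs where

open import Data.Nat as ℕ using (ℕ; zero; suc)
open import Data.Fin using (Fin)
open import Data.List using (List; []; _∷_; foldr; map; length; last)
open import Data.List.Base using (allFin)
open import Data.Maybe using (just)
open import Data.Bool using (Bool; true; false; T)
open import Data.Fin.Subset using (Subset; _∈_; _⊆_; _∩_; Nonempty)
open import Data.Integer using (+_)
open import Data.Rational using (ℚ; 0ℚ; _+_; _*_; _≤_; _<_; _/_)
open import Data.Product using (Σ; ∃; _×_; _,_)
open import Data.List.Relation.Unary.All using (All)
open import Data.List.Relation.Unary.Unique.Propositional using (Unique)
open import Data.List.Relation.Unary.Linked using (Linked)
open import Relation.Binary.PropositionalEquality using (_≡_; _≢_)
open import Relation.Nullary using (¬_)

record Graph (n : ℕ) : Set where
  field
    adj   : Fin n → Fin n → Bool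
    sym   : ∀ x y → adj x y ≡ adj y x
    irrfl : ∀ x → adj x x ≡ false

open Graph public

Adj : ∀ {n} → Graph n → Fin n → Fin n → Set
Adj G x y = T (adj G x y)

data Walk {n} (G : Graph n) : Fin n → Fin n → ℕ → Set where
  here : ∀ {x} → Walk G x x 0
  step : ∀ {x y z k} → Adj G x y → Walk G y z k → Walk G x z (suc k)

Connected : ∀ {n} → Graph n → Set
Connected G = ∀ x y → ∃ λ k → Walk G x y k

IsDistance : ∀ {n} → Graph n → (Fin n → Fin n → ℕ) → Set
IsDistance G d = ∀ x y → Walk G x y (d x y) × (∀ k → Walk G x y k → d x y ℕ.≤ k)

∑ : ∀ {n} → (Fin n → ℚ) → ℚ
∑ {n} f = foldr _+_ 0ℚ (map f (allFin n))

toℚ : ℕ → ℚ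
toℚ k = + k / 1

quadForm : ∀ {n} → (Fin n → Fin n → ℕ) → (Fin n → ℚ) → ℚ
quadForm d f = ∑ λ x → ∑ λ y → f x * (toℚ (d x y) * f y)

normSq : ∀ {n} → (Fin n → ℚ) → ℚ
normSq f = ∑ λ x → f x * f x

-- "QEC(d) < r": there is a rational q < r bounding ⟨f,Df⟩ ≤ q⟨f,f⟩
-- for all rational f with ⟨1,f⟩ = 0.  (By density of ℚ in ℝ and
-- continuity, this is equivalent to the real-valued QEC being < r.)
QECBelow : ∀ {n} → (Fin n → Fin n → ℕ) → ℚ → Set
QECBelow d r = ∃ λ q → q < r × (∀ f → ∑ f ≡ 0ℚ → quadForm d f ≤ q * normSq f)

IsClique : ∀ {n} → Graph n → Subset n → Set
IsClique G S = Nonempty S × (∀ x y → x ∈ S → y ∈ S → x ≢ y → Adj G x y)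

IsMaximalClique : ∀ {n} → Graph n → Subset n → Set
IsMaximalClique G S = IsClique G S × (∀ T → IsClique G T → S ⊆ T → T ⊆ S)

ΓAdj : ∀ {n} → Subset n → Subset n → Set
ΓAdj S T = S ≢ T × Nonempty (S ∩ T)

-- Trees: graphs given by a vertex predicate P on a type A and an
-- adjacency relation R.

data WalkIn {A : Set} (P : A → Set) (R : A → A → Set) : A → A → Set where
  nil  : ∀ {x} → P x → WalkIn P R x x
  cons : ∀ {x y z} → P x → R x y → WalkIn P R y z → WalkIn P R x z

IsCycle : {A : Set} (P : A → Set) (R : A → A → Set) → List A → Set
IsCycle P R []       = Data.Empty.⊥ where import Data.Empty
IsCycle P R (x ∷ xs) =
  3 ℕ.≤ length (x ∷ xs) × All P (x ∷ xs) × Unique (x ∷ xs)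
  × Linked R (x ∷ xs) × (∀ y → last (x ∷ xs) ≡ just y → R y x)

IsTree : {A : Set} (P : A → Set) (R : A → A → Set) → Set
IsTree P R = (∃ λ x → P x)
           × (∀ x y → P x → P y → WalkIn P R x y)
           × (∀ xs → ¬ IsCycle P R xs)

-- Testing QEC(G) < -1/2 on f = δ x₀ - δ x₁ + δ x₂ - δ x₃ and on f = -3 δ v + δ a + δ b + δ c
-- gives ⟨f, D f⟩ + ½ ⟨f, f⟩ < 0, which reads as two metric inequalities: for distinct
-- x₀, …, x₃ the closed walk x₀ x₁ x₂ x₃ is longer than its two diagonals plus one, and G has
-- no induced claw.  Hence every 4-cycle of G has its diagonals, so two distinct maximal
-- cliques meet in at most one vertex and no edge joins them away from it, and no vertex lies
-- in three maximal cliques.  Γ(G) is connected because walks in G lift to Γ(G).  Given a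
-- cycle C₀ C₁ … C_k in Γ(G), pick v₁ ∈ C₀ ∩ C₁ and v₀ ∈ C_k ∩ C₀; they differ because no
-- vertex lies in C₀, C₁ and C_k.  By the four-point inequality, being strictly closer to v₁
-- than to v₀ passes from one vertex of a maximal clique C ≠ C₀ to all vertices of C, so it
-- travels from v₁ ∈ C₁ through C₁, …, C_k, which is absurd for v₀ ∈ C_k.

module Submission where

open import Defs hiding (sym)
open import Data.Empty using (⊥)
open import Data.Fin using (Fin; zero; suc)
open import Data.Fin.Properties using (_≟_; any?; all?)
open import Data.Nat as ℕ using (ℕ; zero; suc; z≤n; s≤s)
import Data.Nat.Properties as ℕₚ
open import Data.Product using (∃; _×_; _,_; proj₁; proj₂)
open import Data.Rational using (-½)
open import Data.Vec using (Vec; lookup; _∷_; [])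
open import Data.Vec.Relation.Unary.All using ([]; _∷_)
open import Data.Vec.Relation.Unary.AllPairs using ([]; _∷_)
open import Data.Vec.Relation.Unary.Unique.Propositional using (Unique)
open import Function using (_∘_)
open import Relation.Binary.PropositionalEquality
open import Relation.Nullary using (¬_; Dec; yes; no; ¬?; _×-dec_; contradiction)

distinct₄ : ∀ {A : Set} {a b c e : A} → a ≢ b → a ≢ c → a ≢ e → b ≢ c → b ≢ e → c ≢ e →
            Unique (a ∷ b ∷ c ∷ e ∷ [])
distinct₄ ab ac ae bc be ce = (ab ∷ ac ∷ ae ∷ []) ∷ (bc ∷ be ∷ []) ∷ (ce ∷ []) ∷ [] ∷ []

module QuadraticTests where

  open import Algebra.Bundles using (CommutativeRing)
  open import Data.Bool using (if_then_else_)
  open import Data.Fin.Patterns using (0F; 1F; 2F; 3F)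
  import Data.Integer as ℤ
  import Data.Integer.Properties as ℤ
  open import Data.List using (tabulate; foldr; map)
  open import Data.List.Properties using (map-tabulate)
  import Data.Nat.Coprimality as Coprimality
  open import Data.Rational
    using (ℚ; mkℚ; _/_; 0ℚ; 1ℚ; ½; -_; _+_; _*_; _-_; _≤_; _<_; *≤*; positive)
  open import Data.Rational.Properties
    using ( normalize-coprime; +-*-commutativeRing; *-identityˡ; *-identityʳ; *-zeroˡ; *-comm
          ; +-identityˡ; +-identityʳ; +-inverseʳ; +-mono-≤; +-monoˡ-≤; +-monoˡ-<; *-monoˡ-<-pos
          ; ≤-<-trans; <-irrefl; positive⁻¹; module ≤-Reasoning)
  open import Data.Rational.Solver using (module +-*-Solver)
  open +-*-Solver using (solve; _:+_; _:*_; _:-_; _:=_; con)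
  import Data.Vec.Functional as Vector
  open import Data.Vec.Relation.Unary.Unique.Propositional.Properties using (lookup-injective)
  open import Function using (id)
  open import Function.Definitions using (Injective)
  open import Relation.Nullary using (does)

  open import Algebra.Properties.Semiring.Sum (CommutativeRing.semiring +-*-commutativeRing)
    using (sum; sum-cong-≗; sum-replicate-zero; ∑-comm; *-distribˡ-sum)

  toℚ≡mkℚ : ∀ k → toℚ k ≡ mkℚ (ℤ.+ k) 0 (Coprimality.sym (Coprimality.1-coprimeTo k))
  toℚ≡mkℚ k = normalize-coprime (Coprimality.sym (Coprimality.1-coprimeTo k))

  toℚ-homo-+ : ∀ a b → toℚ (a ℕ.+ b) ≡ toℚ a + toℚ b
  toℚ-homo-+ a b rewrite toℚ≡mkℚ a | toℚ≡mkℚ b = cong (_/ 1) (begin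
    ℤ.+ (a ℕ.+ b)                         ≡⟨ ℤ.pos-+ a b ⟩
    ℤ.+ a ℤ.+ ℤ.+ b                       ≡⟨ cong₂ ℤ._+_ (ℤ.*-identityʳ (ℤ.+ a)) (ℤ.*-identityʳ (ℤ.+ b)) ⟨
    ℤ.+ a ℤ.* ℤ.+ 1 ℤ.+ ℤ.+ b ℤ.* ℤ.+ 1   ∎)
    where open ≡-Reasoning

  toℚ-homo-* : ∀ a b → toℚ (a ℕ.* b) ≡ toℚ a * toℚ b
  toℚ-homo-* a b rewrite toℚ≡mkℚ a | toℚ≡mkℚ b = cong (_/ 1) (ℤ.pos-* a b)

  toℚ-mono-≤ : ∀ {a b} → a ℕ.≤ b → toℚ a ≤ toℚ b
  toℚ-mono-≤ {a} {b} a≤b rewrite toℚ≡mkℚ a | toℚ≡mkℚ b =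
    *≤* (ℤ.*-monoʳ-≤-nonNeg (ℤ.+ 1) (ℤ.+≤+ a≤b))

  ∑≡sum : ∀ {n} (f : Fin n → ℚ) → ∑ f ≡ sum f
  ∑≡sum {zero}  f = refl
  ∑≡sum {suc n} f = cong (f zero +_) (begin
    foldr _+_ 0ℚ (map f (tabulate suc))   ≡⟨ cong (foldr _+_ 0ℚ) (map-tabulate suc f) ⟩
    foldr _+_ 0ℚ (tabulate (f ∘ suc))     ≡⟨ cong (foldr _+_ 0ℚ) (map-tabulate id (f ∘ suc)) ⟨
    ∑ (f ∘ suc)                           ≡⟨ ∑≡sum (f ∘ suc) ⟩
    sum (f ∘ suc)                         ∎)
    where open ≡-Reasoning

  ∑²≡sum² : ∀ {m n} (f : Fin m → Fin n → ℚ) → ∑ (λ x → ∑ (f x)) ≡ sum (λ x → sum (f x))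
  ∑²≡sum² f = trans (∑≡sum (λ x → ∑ (f x))) (sum-cong-≗ (λ x → ∑≡sum (f x)))

  δ : ∀ {n} → Fin n → Fin n → ℚ
  δ a x = if does (a ≟ x) then 1ℚ else 0ℚ

  δ-suc : ∀ {n} (a x : Fin n) → δ (suc a) (suc x) ≡ δ a x
  δ-suc a x with a ≟ x
  ... | yes refl = refl
  ... | no  _    = refl

  δ-sym : ∀ {n} (a x : Fin n) → δ a x ≡ δ x a
  δ-sym a x with a ≟ x | x ≟ a
  ... | yes _    | yes _    = refl
  ... | no  _    | no  _    = refl
  ... | yes refl | no  x≢a  = contradiction refl x≢a
  ... | no  a≢x  | yes refl = contradiction refl a≢x

  δ-∘-injective : ∀ {k n} {p : Fin k → Fin n} → Injective _≡_ _≡_ p →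
                  ∀ i j → δ (p i) (p j) ≡ δ i j
  δ-∘-injective {p = p} p-injective i j with p i ≟ p j | i ≟ j
  ... | yes _     | yes _    = refl
  ... | no  _     | no  _    = refl
  ... | yes pi≡pj | no  i≢j  = contradiction (p-injective pi≡pj) i≢j
  ... | no  pi≢pj | yes refl = contradiction refl pi≢pj

  sum-δ : ∀ {n} (a : Fin n) (h : Fin n → ℚ) → sum (λ x → δ a x * h x) ≡ h a
  sum-δ {suc n} zero h = begin
    1ℚ * h zero + sum (λ x → 0ℚ * h (suc x))
      ≡⟨ cong₂ _+_ (*-identityˡ (h zero)) (sum-cong-≗ (λ x → *-zeroˡ (h (suc x)))) ⟩
    h zero + sum {n} (λ _ → 0ℚ)               ≡⟨ cong (h zero +_) (sum-replicate-zero n) ⟩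
    h zero + 0ℚ                               ≡⟨ +-identityʳ (h zero) ⟩
    h zero                                    ∎
    where open ≡-Reasoning
  sum-δ {suc n} (suc a) h = begin
    0ℚ * h zero + sum (λ x → δ (suc a) (suc x) * h (suc x))
      ≡⟨ cong₂ _+_ (*-zeroˡ (h zero)) (sum-cong-≗ (λ x → cong (_* h (suc x)) (δ-suc a x))) ⟩
    0ℚ + sum (λ x → δ a x * h (suc x))        ≡⟨ +-identityˡ _ ⟩
    sum (λ x → δ a x * h (suc x))             ≡⟨ sum-δ a (h ∘ suc) ⟩
    h (suc a)                                 ∎
    where open ≡-Reasoning

  ∣_∣² : ∀ {k} → (Fin k → ℚ) → ℚ
  ∣ c ∣² = sum (λ i → c i * c i)

  pointMasses : ∀ {k n} → (Fin k → Fin n) → (Fin k → ℚ) → Fin n → ℚ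
  pointMasses p c x = sum (λ i → c i * δ (p i) x)

  module _ {k n} (p : Fin k → Fin n) (c : Fin k → ℚ) where

    sum-*-pointMasses : ∀ (h : Fin n → ℚ) →
      sum (λ x → h x * pointMasses p c x) ≡ sum (λ i → c i * h (p i))
    sum-*-pointMasses h = begin
      sum (λ x → h x * sum (λ i → c i * δ (p i) x))
        ≡⟨ sum-cong-≗ (λ x → *-distribˡ-sum (h x) (λ i → c i * δ (p i) x)) ⟩
      sum (λ x → sum (λ i → h x * (c i * δ (p i) x)))
        ≡⟨ ∑-comm (λ x i → h x * (c i * δ (p i) x)) ⟩
      sum (λ i → sum (λ x → h x * (c i * δ (p i) x)))
        ≡⟨ sum-cong-≗ (λ i → sum-cong-≗ (λ x → rearrange (h x) (c i) (δ (p i) x))) ⟩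
      sum (λ i → sum (λ x → c i * (δ (p i) x * h x)))
        ≡⟨ sum-cong-≗ (λ i → *-distribˡ-sum (c i) (λ x → δ (p i) x * h x)) ⟨
      sum (λ i → c i * sum (λ x → δ (p i) x * h x))
        ≡⟨ sum-cong-≗ (λ i → cong (c i *_) (sum-δ (p i) h)) ⟩
      sum (λ i → c i * h (p i))
        ∎
      where
      open ≡-Reasoning
      rearrange : ∀ a b e → a * (b * e) ≡ b * (e * a)
      rearrange = solve 3 (λ a b e → a :* (b :* e) := b :* (e :* a)) refl

    ∑-pointMasses : ∑ (pointMasses p c) ≡ sum c
    ∑-pointMasses = begin
      ∑ (pointMasses p c)                  ≡⟨ ∑≡sum (pointMasses p c) ⟩
      sum (pointMasses p c)                ≡⟨ sum-cong-≗ (λ x → *-identityˡ (pointMasses p c x)) ⟨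
      sum (λ x → 1ℚ * pointMasses p c x)   ≡⟨ sum-*-pointMasses (λ _ → 1ℚ) ⟩
      sum (λ i → c i * 1ℚ)                 ≡⟨ sum-cong-≗ (λ i → *-identityʳ (c i)) ⟩
      sum c                                ∎
      where open ≡-Reasoning

    pointMasses-at : Injective _≡_ _≡_ p → ∀ i → pointMasses p c (p i) ≡ c i
    pointMasses-at p-injective i = begin
      sum (λ j → c j * δ (p j) (p i))
        ≡⟨ sum-cong-≗ (λ j → trans (*-comm (c j) _) (cong (_* c j) δ[pj,pi]≡δ[i,j])) ⟩
      sum (λ j → δ i j * c j)   ≡⟨ sum-δ i c ⟩
      c i                       ∎
      where
      open ≡-Reasoning
      δ[pj,pi]≡δ[i,j] : ∀ {j} → δ (p j) (p i) ≡ δ i j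
      δ[pj,pi]≡δ[i,j] {j} = trans (δ-∘-injective p-injective j i) (δ-sym j i)

    normSq-pointMasses : Injective _≡_ _≡_ p → normSq (pointMasses p c) ≡ ∣ c ∣²
    normSq-pointMasses p-injective = begin
      normSq f                     ≡⟨ ∑≡sum (λ x → f x * f x) ⟩
      sum (λ x → f x * f x)        ≡⟨ sum-*-pointMasses f ⟩
      sum (λ i → c i * f (p i))    ≡⟨ sum-cong-≗ (λ i → cong (c i *_) (pointMasses-at p-injective i)) ⟩
      ∣ c ∣²                       ∎
      where
      open ≡-Reasoning
      f = pointMasses p c

    quadratic-pointMasses : ∀ (K : Fin n → Fin n → ℚ) →
      ∑ (λ x → ∑ (λ y → pointMasses p c x * (K x y * pointMasses p c y)))
        ≡ sum (λ i → c i * sum (λ j → c j * K (p i) (p j)))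
    quadratic-pointMasses K = begin
      ∑ (λ x → ∑ (λ y → f x * (K x y * f y)))
        ≡⟨ ∑²≡sum² (λ x y → f x * (K x y * f y)) ⟩
      sum (λ x → sum (λ y → f x * (K x y * f y)))
        ≡⟨ sum-cong-≗ (λ x → *-distribˡ-sum (f x) (λ y → K x y * f y)) ⟨
      sum (λ x → f x * sum (λ y → K x y * f y))
        ≡⟨ sum-cong-≗ (λ x → cong (f x *_) (sum-*-pointMasses (K x))) ⟩
      sum (λ x → f x * g x)
        ≡⟨ sum-cong-≗ (λ x → *-comm (f x) (g x)) ⟩
      sum (λ x → g x * f x)
        ≡⟨ sum-*-pointMasses g ⟩
      sum (λ i → c i * g (p i))
        ∎
      where
      open ≡-Reasoning
      f = pointMasses p c
      g : Fin n → ℚ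
      g x = sum (λ j → c j * K x (p j))

  sumOverPairs₄ : (Fin 4 → ℚ) → (Fin 4 → Fin 4 → ℚ) → ℚ
  sumOverPairs₄ c K = c 0F * c 1F * K 0F 1F + c 0F * c 2F * K 0F 2F + c 0F * c 3F * K 0F 3F
                    + c 1F * c 2F * K 1F 2F + c 1F * c 3F * K 1F 3F + c 2F * c 3F * K 2F 3F

  quadratic-symmetric₄ : ∀ (c : Fin 4 → ℚ) (K : Fin 4 → Fin 4 → ℚ) →
    (∀ i → K i i ≡ 0ℚ) → (∀ i j → K i j ≡ K j i) →
    sum (λ i → c i * sum (λ j → c j * K i j)) ≡ sumOverPairs₄ c K + sumOverPairs₄ c K
  quadratic-symmetric₄ c K K-diag K-sym
    rewrite K-diag 0F | K-diag 1F | K-diag 2F | K-diag 3F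
          | K-sym 1F 0F | K-sym 2F 0F | K-sym 3F 0F | K-sym 2F 1F | K-sym 3F 1F | K-sym 3F 2F =
    solve 10 (λ c₀ c₁ c₂ c₃ k₀₁ k₀₂ k₀₃ k₁₂ k₁₃ k₂₃ →
        c₀ :* (c₀ :* con 0ℚ :+ (c₁ :* k₀₁ :+ (c₂ :* k₀₂ :+ (c₃ :* k₀₃ :+ con 0ℚ))))
        :+ (c₁ :* (c₀ :* k₀₁ :+ (c₁ :* con 0ℚ :+ (c₂ :* k₁₂ :+ (c₃ :* k₁₃ :+ con 0ℚ))))
        :+ (c₂ :* (c₀ :* k₀₂ :+ (c₁ :* k₁₂ :+ (c₂ :* con 0ℚ :+ (c₃ :* k₂₃ :+ con 0ℚ))))
        :+ (c₃ :* (c₀ :* k₀₃ :+ (c₁ :* k₁₃ :+ (c₂ :* k₂₃ :+ (c₃ :* con 0ℚ :+ con 0ℚ))))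
        :+ con 0ℚ)))
      := pairs c₀ c₁ c₂ c₃ k₀₁ k₀₂ k₀₃ k₁₂ k₁₃ k₂₃ :+ pairs c₀ c₁ c₂ c₃ k₀₁ k₀₂ k₀₃ k₁₂ k₁₃ k₂₃)
      refl (c 0F) (c 1F) (c 2F) (c 3F) (K 0F 1F) (K 0F 2F) (K 0F 3F) (K 1F 2F) (K 1F 3F) (K 2F 3F)
    where
    pairs = λ c₀ c₁ c₂ c₃ k₀₁ k₀₂ k₀₃ k₁₂ k₁₃ k₂₃ →
      c₀ :* c₁ :* k₀₁ :+ c₀ :* c₂ :* k₀₂ :+ c₀ :* c₃ :* k₀₃
      :+ c₁ :* c₂ :* k₁₂ :+ c₁ :* c₃ :* k₁₃ :+ c₂ :* c₃ :* k₂₃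

  QECBelow-½⇒quadForm+½normSq<0 : ∀ {n} {d : Fin n → Fin n → ℕ} → QECBelow d -½ →
    ∀ f → ∑ f ≡ 0ℚ → 0ℚ < normSq f → quadForm d f + ½ * normSq f < 0ℚ
  QECBelow-½⇒quadForm+½normSq<0 {d = d} (q , q<-½ , bound) f ∑f≡0 0<‖f‖² = begin-strict
    quadForm d f + ½ * ‖f‖²    ≤⟨ +-monoˡ-≤ (½ * ‖f‖²) (bound f ∑f≡0) ⟩
    q * ‖f‖² + ½ * ‖f‖²        <⟨ +-monoˡ-< (½ * ‖f‖²) (*-monoˡ-<-pos ‖f‖² {{positive 0<‖f‖²}} q<-½) ⟩
    -½ * ‖f‖² + ½ * ‖f‖²       ≡⟨ solve 1 (λ x → con -½ :* x :+ con ½ :* x := con 0ℚ) refl ‖f‖² ⟩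
    0ℚ                         ∎
    where
    open ≤-Reasoning
    ‖f‖² = normSq f

  module _ {n} {d : Fin n → Fin n → ℕ} (d-diag : ∀ x → d x x ≡ 0) (d-sym : ∀ x y → d x y ≡ d y x)
           (qec : QECBelow d -½) where

    -- E + E is ⟨f, D f⟩ for f = Σᵢ c i · δ (lookup xs i); the caller evaluates
    -- ⟨f, D f⟩ + ½ ⟨f, f⟩ as twice a difference of naturals a and b.
    QECBelow-½-four-point-test : ∀ (xs : Vec (Fin n) 4) → Unique xs → (c : Fin 4 → ℚ) →
      sum c ≡ 0ℚ → 0ℚ < ∣ c ∣² → ∀ a b →
      let E = sumOverPairs₄ c (λ i j → toℚ (d (lookup xs i) (lookup xs j))) in
      E + E + ½ * ∣ c ∣² ≡ (toℚ a - toℚ b) + (toℚ a - toℚ b) → a ℕ.< b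
    QECBelow-½-four-point-test xs xs-unique c ∑c≡0 0<∣c∣² a b test≡ = ℕₚ.≰⇒> λ b≤a →
      <-irrefl refl (≤-<-trans (subst (0ℚ ≤_) (sym test≡) (+-mono-≤ (0≤a-b b≤a) (0≤a-b b≤a))) test<0)
      where
      p = lookup xs
      f = pointMasses p c
      p-injective : Injective _≡_ _≡_ p
      p-injective = lookup-injective xs-unique _ _
      K : Fin 4 → Fin 4 → ℚ
      K i j = toℚ (d (p i) (p j))
      quadForm≡ : quadForm d f ≡ sumOverPairs₄ c K + sumOverPairs₄ c K
      quadForm≡ = trans (quadratic-pointMasses p c (λ x y → toℚ (d x y)))
        (quadratic-symmetric₄ c K (λ i → cong toℚ (d-diag (p i))) (λ i j → cong toℚ (d-sym (p i) (p j))))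
      test<0 : sumOverPairs₄ c K + sumOverPairs₄ c K + ½ * ∣ c ∣² < 0ℚ
      test<0 = subst₂ (λ Q N → Q + ½ * N < 0ℚ) quadForm≡ (normSq-pointMasses p c p-injective)
        (QECBelow-½⇒quadForm+½normSq<0 {d = d} qec f (trans (∑-pointMasses p c) ∑c≡0)
          (subst (0ℚ <_) (sym (normSq-pointMasses p c p-injective)) 0<∣c∣²))
      0≤a-b : b ℕ.≤ a → 0ℚ ≤ toℚ a - toℚ b
      0≤a-b b≤a = subst (_≤ toℚ a - toℚ b) (+-inverseʳ (toℚ b)) (+-monoˡ-≤ (- toℚ b) (toℚ-mono-≤ b≤a))

    four-point-inequality : ∀ {x₀ x₁ x₂ x₃} → Unique (x₀ ∷ x₁ ∷ x₂ ∷ x₃ ∷ []) →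
      d x₀ x₂ ℕ.+ d x₁ x₃ ℕ.+ 1 ℕ.< d x₀ x₁ ℕ.+ d x₁ x₂ ℕ.+ d x₂ x₃ ℕ.+ d x₃ x₀
    four-point-inequality {x₀} {x₁} {x₂} {x₃} distinct =
      QECBelow-½-four-point-test (x₀ ∷ x₁ ∷ x₂ ∷ x₃ ∷ []) distinct c refl (positive⁻¹ _) _ _ (begin
        _ ≡⟨ solve 6 (λ d₀₁ d₀₂ d₀₃ d₁₂ d₁₃ d₂₃ →
               let E = con 1ℚ :* con (- 1ℚ) :* d₀₁ :+ con 1ℚ :* con 1ℚ :* d₀₂
                       :+ con 1ℚ :* con (- 1ℚ) :* d₀₃ :+ con (- 1ℚ) :* con 1ℚ :* d₁₂
                       :+ con (- 1ℚ) :* con (- 1ℚ) :* d₁₃ :+ con 1ℚ :* con (- 1ℚ) :* d₂₃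
                   T-S = d₀₂ :+ d₁₃ :+ con 1ℚ :- (d₀₁ :+ d₁₂ :+ d₂₃ :+ d₀₃)
               in  E :+ E :+ con ½ :* con ∣ c ∣² := T-S :+ T-S)
             refl (D x₀ x₁) (D x₀ x₂) (D x₀ x₃) (D x₁ x₂) (D x₁ x₃) (D x₂ x₃) ⟩
        (T - S) + (T - S)   ≡⟨ cong₂ (λ t s → (t - s) + (t - s)) toℚ-T toℚ-S ⟨
        _                   ∎)
      where
      open ≡-Reasoning
      c : Fin 4 → ℚ
      c = 1ℚ Vector.∷ - 1ℚ Vector.∷ 1ℚ Vector.∷ - 1ℚ Vector.∷ Vector.[]
      D : Fin n → Fin n → ℚ
      D x y = toℚ (d x y)
      T = D x₀ x₂ + D x₁ x₃ + 1ℚ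
      S = D x₀ x₁ + D x₁ x₂ + D x₂ x₃ + D x₀ x₃
      toℚ-T : toℚ (d x₀ x₂ ℕ.+ d x₁ x₃ ℕ.+ 1) ≡ T
      toℚ-T = trans (toℚ-homo-+ (d x₀ x₂ ℕ.+ d x₁ x₃) 1)
                    (cong (_+ 1ℚ) (toℚ-homo-+ (d x₀ x₂) (d x₁ x₃)))
      toℚ-S : toℚ (d x₀ x₁ ℕ.+ d x₁ x₂ ℕ.+ d x₂ x₃ ℕ.+ d x₃ x₀) ≡ S
      toℚ-S = trans (toℚ-homo-+ (d x₀ x₁ ℕ.+ d x₁ x₂ ℕ.+ d x₂ x₃) (d x₃ x₀))
        (cong₂ _+_ (trans (toℚ-homo-+ (d x₀ x₁ ℕ.+ d x₁ x₂) (d x₂ x₃))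
                          (cong (_+ D x₂ x₃) (toℚ-homo-+ (d x₀ x₁) (d x₁ x₂))))
                   (cong toℚ (d-sym x₃ x₀)))

    claw-inequality : ∀ {v a b c} → Unique (v ∷ a ∷ b ∷ c ∷ []) →
      d a b ℕ.+ d a c ℕ.+ d b c ℕ.+ 3 ℕ.< 3 ℕ.* (d v a ℕ.+ d v b ℕ.+ d v c)
    claw-inequality {v} {a} {b} {c} distinct =
      QECBelow-½-four-point-test (v ∷ a ∷ b ∷ c ∷ []) distinct w refl (positive⁻¹ _) _ _ (begin
        _ ≡⟨ solve 6 (λ dva dvb dvc dab dac dbc →
               let E = con (- toℚ 3) :* con 1ℚ :* dva :+ con (- toℚ 3) :* con 1ℚ :* dvb
                       :+ con (- toℚ 3) :* con 1ℚ :* dvc :+ con 1ℚ :* con 1ℚ :* dab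
                       :+ con 1ℚ :* con 1ℚ :* dac :+ con 1ℚ :* con 1ℚ :* dbc
                   T-S = dab :+ dac :+ dbc :+ con (toℚ 3) :- con (toℚ 3) :* (dva :+ dvb :+ dvc)
               in  E :+ E :+ con ½ :* con ∣ w ∣² := T-S :+ T-S)
             refl (D v a) (D v b) (D v c) (D a b) (D a c) (D b c) ⟩
        (T - S) + (T - S)   ≡⟨ cong₂ (λ t s → (t - s) + (t - s)) toℚ-T toℚ-S ⟨
        _                   ∎)
      where
      open ≡-Reasoning
      w : Fin 4 → ℚ
      w = - toℚ 3 Vector.∷ 1ℚ Vector.∷ 1ℚ Vector.∷ 1ℚ Vector.∷ Vector.[]
      D : Fin n → Fin n → ℚ
      D x y = toℚ (d x y)
      T = D a b + D a c + D b c + toℚ 3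
      S = toℚ 3 * (D v a + D v b + D v c)
      toℚ-T : toℚ (d a b ℕ.+ d a c ℕ.+ d b c ℕ.+ 3) ≡ T
      toℚ-T = trans (toℚ-homo-+ (d a b ℕ.+ d a c ℕ.+ d b c) 3)
        (cong (_+ toℚ 3) (trans (toℚ-homo-+ (d a b ℕ.+ d a c) (d b c))
                                (cong (_+ D b c) (toℚ-homo-+ (d a b) (d a c)))))
      toℚ-S : toℚ (3 ℕ.* (d v a ℕ.+ d v b ℕ.+ d v c)) ≡ S
      toℚ-S = trans (toℚ-homo-* 3 (d v a ℕ.+ d v b ℕ.+ d v c))
        (cong (toℚ 3 *_) (trans (toℚ-homo-+ (d v a ℕ.+ d v b) (d v c))
                                (cong (_+ D v c) (toℚ-homo-+ (d v a) (d v b)))))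

open QuadraticTests using (four-point-inequality; claw-inequality)

import Data.Bool as Bool
open import Data.Bool using (T)
open import Data.Fin.Subset using (Subset; _∈_; _∉_; _⊆_; _⊂_; _⊃_; _∪_; ⁅_⁆)
open import Data.Fin.Subset.Properties
  using (_∈?_; x∈p∪q⁺; x∈p∪q⁻; p⊆p∪q; x∈⁅x⁆; x∈⁅y⁆⇒x≡y; ⊆-antisym; x∈p∩q⁺; x∈p∩q⁻)
open import Data.Fin.Subset.Induction using (⊃-wellFounded)
open import Data.List using (_∷_; []; last)
open import Data.List.Relation.Unary.All as All using (All; _∷_; [])
open import Data.List.Relation.Unary.All.Properties using (last⁺)
open import Data.List.Relation.Unary.AllPairs using (_∷_)
open import Data.List.Relation.Unary.Linked using (Linked; [-]; _∷_)
open import Data.Maybe using (just)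
import Data.Maybe.Relation.Unary.All as Maybe
open import Data.Maybe.Relation.Unary.All using (drop-just)
open import Data.Nat using (_+_; _*_; _≤_; _<_)
open import Data.Nat.Tactic.RingSolver using (solve-∀)
open import Data.Sum using (_⊎_; inj₁; inj₂)
open import Data.Vec.Properties using (≡-dec)
open import Induction.WellFounded using (Acc; acc)
open import Relation.Nullary.Decidable using (T?; decidable-stable; _→-dec_)
open ℕₚ using (+-mono-≤; +-monoˡ-≤; *-monoʳ-≤; ≤-<-trans; <-≤-trans; <⇒≱; ≰⇒>; module ≤-Reasoning)

last-∷ : ∀ {A : Set} (x : A) xs → ∃ λ y → last (x ∷ xs) ≡ just y
last-∷ x []        = x , refl
last-∷ x (x' ∷ xs) = last-∷ x' xs

All-last : ∀ {A : Set} {P : A → Set} {xs y} → All P xs → last xs ≡ just y → P y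
All-last {P = P} Pxs last≡y = drop-just (subst (Maybe.All P) last≡y (last⁺ Pxs))

module _ {n} (G : Graph n) where

  Adj-sym : ∀ {x y} → Adj G x y → Adj G y x
  Adj-sym {x} {y} = subst T (Graph.sym G x y)

  Adj⇒≢ : ∀ {x y} → Adj G x y → x ≢ y
  Adj⇒≢ {x} xy refl = subst T (irrfl G x) xy

  Adj? : ∀ x y → Dec (Adj G x y)
  Adj? x y = T? (adj G x y)

  Walk-snoc : ∀ {x y z k} → Walk G x y k → Adj G y z → Walk G x z (suc k)
  Walk-snoc here         yz = step yz here
  Walk-snoc (step xw wy) yz = step xw (Walk-snoc wy yz)

  Walk-reverse : ∀ {x y k} → Walk G x y k → Walk G y x k
  Walk-reverse here         = here
  Walk-reverse (step xw wy) = Walk-snoc (Walk-reverse wy) (Adj-sym xw)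

module Distance {n} {G : Graph n} {d : Fin n → Fin n → ℕ} (isd : IsDistance G d) where

  d-minimal : ∀ {x y k} → Walk G x y k → d x y ≤ k
  d-minimal w = proj₂ (isd _ _) _ w

  d-sym : ∀ x y → d x y ≡ d y x
  d-sym x y = ℕₚ.≤-antisym (d-minimal (Walk-reverse G (proj₁ (isd y x))))
                           (d-minimal (Walk-reverse G (proj₁ (isd x y))))

  d-diag : ∀ x → d x x ≡ 0
  d-diag x = ℕₚ.n≤0⇒n≡0 (d-minimal here)

  Adj⇒d≤1 : ∀ {x y} → Adj G x y → d x y ≤ 1
  Adj⇒d≤1 xy = d-minimal (step xy here)

  ≢⇒1≤d : ∀ {x y} → x ≢ y → 1 ≤ d x y
  ≢⇒1≤d {x} {y} x≢y with d x y | proj₁ (isd x y)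
  ... | zero  | here = contradiction refl x≢y
  ... | suc _ | _    = s≤s z≤n

  ≢∧¬Adj⇒2≤d : ∀ {x y} → x ≢ y → ¬ Adj G x y → 2 ≤ d x y
  ≢∧¬Adj⇒2≤d {x} {y} x≢y ¬xy with d x y | proj₁ (isd x y)
  ... | zero        | here         = contradiction refl x≢y
  ... | suc zero    | step xy here = contradiction xy ¬xy
  ... | suc (suc _) | _            = s≤s (s≤s z≤n)

module ForbiddenSubgraphs {n} {G : Graph n} {d : Fin n → Fin n → ℕ}
                          (isd : IsDistance G d) (qec : QECBelow d -½) where
  open Distance isd
  open ≤-Reasoning

  square⇒diagonal : ∀ {p q r s} → Adj G p q → Adj G q r → Adj G r s → Adj G s p → p ≢ r → q ≢ s →
                    Adj G p r
  square⇒diagonal {p} {q} {r} {s} pq qr rs sp p≢r q≢s = decidable-stable (Adj? G p r) λ ¬pr →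
    <⇒≱ (four-point-inequality d-diag d-sym qec distinct) (begin
      d p q + d q r + d r s + d s p
        ≤⟨ +-mono-≤ (+-mono-≤ (+-mono-≤ (Adj⇒d≤1 pq) (Adj⇒d≤1 qr)) (Adj⇒d≤1 rs)) (Adj⇒d≤1 sp) ⟩
      4
        ≤⟨ +-monoˡ-≤ 1 (+-mono-≤ (≢∧¬Adj⇒2≤d p≢r ¬pr) (≢⇒1≤d q≢s)) ⟩
      d p r + d q s + 1 ∎)
    where
    distinct = distinct₄ (Adj⇒≢ G pq) p≢r (≢-sym (Adj⇒≢ G sp)) (Adj⇒≢ G qr) q≢s (Adj⇒≢ G rs)

  claw-free : ∀ {v a b c} → Adj G v a → Adj G v b → Adj G v c → a ≢ b → a ≢ c → b ≢ c →
              ¬ Adj G a b → ¬ Adj G a c → ¬ Adj G b c → ⊥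
  claw-free {v} {a} {b} {c} va vb vc a≢b a≢c b≢c ¬ab ¬ac ¬bc =
    <⇒≱ (claw-inequality d-diag d-sym qec distinct) (begin
      3 * (d v a + d v b + d v c)
        ≤⟨ *-monoʳ-≤ 3 (+-mono-≤ (+-mono-≤ (Adj⇒d≤1 va) (Adj⇒d≤1 vb)) (Adj⇒d≤1 vc)) ⟩
      9
        ≤⟨ +-monoˡ-≤ 3 (+-mono-≤ (+-mono-≤ (≢∧¬Adj⇒2≤d a≢b ¬ab) (≢∧¬Adj⇒2≤d a≢c ¬ac))
                                 (≢∧¬Adj⇒2≤d b≢c ¬bc)) ⟩
      d a b + d a c + d b c + 3 ∎)
    where
    distinct = distinct₄ (Adj⇒≢ G va) (Adj⇒≢ G vb) (Adj⇒≢ G vc) a≢b a≢c b≢c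

module Cliques {n} (G : Graph n) where

  clique-adj : ∀ {S x y} → IsClique G S → x ∈ S → y ∈ S → x ≢ y → Adj G x y
  clique-adj S-clique = proj₂ S-clique _ _

  Extends : Subset n → Fin n → Set
  Extends S z = z ∉ S × (∀ w → w ∈ S → Adj G z w)

  extends? : ∀ S z → Dec (Extends S z)
  extends? S z = ¬? (z ∈? S) ×-dec all? (λ w → w ∈? S →-dec Adj? G z w)

  clique-∪⁅⁆ : ∀ {S z} → IsClique G S → Extends S z → IsClique G (S ∪ ⁅ z ⁆)
  clique-∪⁅⁆ {S} {z} S-clique (_ , z-adj) = (z , x∈p∪q⁺ (inj₂ (x∈⁅x⁆ z))) , λ x y x∈ y∈ →
    adjacent (x∈p∪q⁻ S ⁅ z ⁆ x∈) (x∈p∪q⁻ S ⁅ z ⁆ y∈)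
    where
    adjacent : ∀ {x y} → x ∈ S ⊎ x ∈ ⁅ z ⁆ → y ∈ S ⊎ y ∈ ⁅ z ⁆ → x ≢ y → Adj G x y
    adjacent (inj₁ x∈S) (inj₁ y∈S) x≢y = clique-adj S-clique x∈S y∈S x≢y
    adjacent (inj₁ x∈S) (inj₂ y∈z) _ rewrite x∈⁅y⁆⇒x≡y z y∈z = Adj-sym G (z-adj _ x∈S)
    adjacent (inj₂ x∈z) (inj₁ y∈S) _ rewrite x∈⁅y⁆⇒x≡y z x∈z = z-adj _ y∈S
    adjacent (inj₂ x∈z) (inj₂ y∈z) x≢y =
      contradiction (trans (x∈⁅y⁆⇒x≡y z x∈z) (sym (x∈⁅y⁆⇒x≡y z y∈z))) x≢y

  ⊂-∪⁅⁆ : ∀ {S : Subset n} {z} → z ∉ S → S ⊂ S ∪ ⁅ z ⁆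
  ⊂-∪⁅⁆ {z = z} z∉S = p⊆p∪q ⁅ z ⁆ , z , x∈p∪q⁺ (inj₂ (x∈⁅x⁆ z)) , z∉S

  maximal⇒¬Extends : ∀ {S z} → IsMaximalClique G S → ¬ Extends S z
  maximal⇒¬Extends {S} {z} (S-clique , S-max) z-ext@(z∉S , _) =
    z∉S (S-max _ (clique-∪⁅⁆ S-clique z-ext) (p⊆p∪q ⁅ z ⁆) (x∈p∪q⁺ (inj₂ (x∈⁅x⁆ z))))

  ¬Extends⇒maximal : ∀ {S} → IsClique G S → (∀ z → ¬ Extends S z) → IsMaximalClique G S
  ¬Extends⇒maximal {S} S-clique no-ext = S-clique , λ T T-clique S⊆T {x} x∈T →
    decidable-stable (x ∈? S) λ x∉S →
      no-ext x (x∉S , λ w w∈S → clique-adj T-clique x∈T (S⊆T w∈S) λ { refl → x∉S w∈S })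

  extend-to-maximal : ∀ {S} → IsClique G S → ∃ λ M → IsMaximalClique G M × S ⊆ M
  extend-to-maximal {S} = go (⊃-wellFounded S)
    where
    go : ∀ {S} → Acc _⊃_ S → IsClique G S → ∃ λ M → IsMaximalClique G M × S ⊆ M
    go {S} (acc larger) S-clique with any? (extends? S)
    ... | no  none        = S , ¬Extends⇒maximal S-clique (λ z z-ext → none (z , z-ext)) , λ x∈S → x∈S
    ... | yes (z , z-ext) =
      let M , M-max , S∪z⊆M = go (larger (⊂-∪⁅⁆ (proj₁ z-ext))) (clique-∪⁅⁆ S-clique z-ext)
      in  M , M-max , S∪z⊆M ∘ p⊆p∪q ⁅ z ⁆

  maximal-nonneighbour : ∀ {S z} → IsMaximalClique G S → z ∉ S → ∃ λ w → w ∈ S × ¬ Adj G z w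
  maximal-nonneighbour {S} {z} S-max z∉S with any? (λ w → w ∈? S ×-dec ¬? (Adj? G z w))
  ... | yes found = found
  ... | no  none  = contradiction
    (z∉S , λ w w∈S → decidable-stable (Adj? G z w) λ ¬zw → none (w , w∈S , ¬zw))
    (maximal⇒¬Extends S-max)

  maximal-⊈ : ∀ {S T} → IsMaximalClique G S → IsMaximalClique G T → S ≢ T → ∃ λ x → x ∈ S × x ∉ T
  maximal-⊈ {S} {T} (_ , S-max) (T-clique , _) S≢T with any? (λ x → x ∈? S ×-dec ¬? (x ∈? T))
  ... | yes found = found
  ... | no  none  = contradiction (⊆-antisym {n} S⊆T (S-max T T-clique S⊆T)) S≢T
    where
    S⊆T : S ⊆ T
    S⊆T {x} x∈S = decidable-stable (x ∈? T) λ x∉T → none (x , x∈S , x∉T)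

  ⁅⁆-clique : ∀ x → IsClique G ⁅ x ⁆
  ⁅⁆-clique x = (x , x∈⁅x⁆ x) , λ a b a∈ b∈ →
    contradiction (trans (x∈⁅y⁆⇒x≡y x a∈) (sym (x∈⁅y⁆⇒x≡y x b∈)))

  edge-in-maximal : ∀ {x y} → Adj G x y → ∃ λ M → IsMaximalClique G M × x ∈ M × y ∈ M
  edge-in-maximal {x} {y} xy =
    let M , M-max , x∪y⊆M = extend-to-maximal (clique-∪⁅⁆ (⁅⁆-clique x) y-ext)
    in  M , M-max , x∪y⊆M (p⊆p∪q ⁅ y ⁆ (x∈⁅x⁆ x)) , x∪y⊆M (x∈p∪q⁺ (inj₂ (x∈⁅x⁆ y)))
    where
    y-ext : Extends ⁅ x ⁆ y
    y-ext = (λ y∈⁅x⁆ → Adj⇒≢ G xy (sym (x∈⁅y⁆⇒x≡y x y∈⁅x⁆)))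
          , λ w w∈⁅x⁆ → subst (Adj G y) (sym (x∈⁅y⁆⇒x≡y x w∈⁅x⁆)) (Adj-sym G xy)

  Γ-prepend : ∀ {S M T x} → IsMaximalClique G S → x ∈ S → x ∈ M →
              WalkIn (IsMaximalClique G) ΓAdj M T → WalkIn (IsMaximalClique G) ΓAdj S T
  Γ-prepend {S} {M} S-max x∈S x∈M w with ≡-dec Bool._≟_ S M
  ... | yes refl = w
  ... | no  S≢M  = cons S-max (S≢M , _ , x∈p∩q⁺ (x∈S , x∈M)) w

  Γ-walk : ∀ {x y k S T} → Walk G x y k → IsMaximalClique G S → IsMaximalClique G T →
           x ∈ S → y ∈ T → WalkIn (IsMaximalClique G) ΓAdj S T
  Γ-walk here         S-max T-max x∈S x∈T = Γ-prepend S-max x∈S x∈T (nil T-max)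
  Γ-walk (step xz zy) S-max T-max x∈S y∈T =
    let M , M-max , x∈M , z∈M = edge-in-maximal xz
    in  Γ-prepend S-max x∈S x∈M (Γ-walk zy M-max T-max z∈M y∈T)

module MaximalCliques {n} {G : Graph n} {d : Fin n → Fin n → ℕ}
                      (isd : IsDistance G d) (qec : QECBelow d -½) where
  open Cliques G
  open ForbiddenSubgraphs isd qec

  maximal-∩-subsingleton : ∀ {S T x y} → IsMaximalClique G S → IsMaximalClique G T → S ≢ T →
                           x ∈ S → x ∈ T → y ∈ S → y ∈ T → x ≡ y
  maximal-∩-subsingleton {S} {T} {x} {y} S-max@(S-clique , _) T-max@(T-clique , _) S≢T
                         x∈S x∈T y∈S y∈T
    with maximal-⊈ S-max T-max S≢T
  ... | s , s∈S , s∉T with maximal-nonneighbour T-max s∉T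
  ... | t , t∈T , ¬st = decidable-stable (x ≟ y) λ x≢y →
    ¬st (square⇒diagonal sx xt ty (Adj-sym G sy) (s≢ t∈T) x≢y)
    where
    s≢ : ∀ {z} → z ∈ T → s ≢ z
    s≢ z∈T refl = s∉T z∈T
    sx = clique-adj S-clique s∈S x∈S (s≢ x∈T)
    sy = clique-adj S-clique s∈S y∈S (s≢ y∈T)
    xt = clique-adj T-clique x∈T t∈T λ { refl → ¬st sx }
    ty = clique-adj T-clique t∈T y∈T λ { refl → ¬st sy }

  maximal-∩-no-edge : ∀ {A B v a b} → IsMaximalClique G A → IsMaximalClique G B → A ≢ B →
                      v ∈ A → v ∈ B → a ∈ A → b ∈ B → a ≢ v → b ≢ v → ¬ Adj G a b
  maximal-∩-no-edge {A} {B} {v} {a} {b} A-max@(A-clique , _) B-max@(B-clique , _) A≢B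
                    v∈A v∈B a∈A b∈B a≢v b≢v ab
    with b ∈? A
  ... | yes b∈A = b≢v (maximal-∩-subsingleton A-max B-max A≢B b∈A b∈B v∈A v∈B)
  ... | no  b∉A with maximal-nonneighbour A-max b∉A
  ... | a' , a'∈A , ¬ba' =
    ¬ba' (Adj-sym G (square⇒diagonal a'v vb (Adj-sym G ab) aa' (λ { refl → b∉A a'∈A }) (≢-sym a≢v)))
    where
    vb  = clique-adj B-clique v∈B b∈B (≢-sym b≢v)
    a'v = clique-adj A-clique a'∈A v∈A λ { refl → ¬ba' (Adj-sym G vb) }
    aa' = clique-adj A-clique a∈A a'∈A λ { refl → ¬ba' (Adj-sym G ab) }

  maximal-∩₃-empty : ∀ {A B C v} → IsMaximalClique G A → IsMaximalClique G B → IsMaximalClique G C →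
                     A ≢ B → A ≢ C → B ≢ C → v ∈ A → v ∈ B → v ∈ C → ⊥
  maximal-∩₃-empty {A} {B} {C} {v} A-max B-max C-max A≢B A≢C B≢C v∈A v∈B v∈C
    with maximal-⊈ A-max B-max A≢B | maximal-⊈ B-max C-max B≢C | maximal-⊈ C-max A-max (≢-sym A≢C)
  ... | a , a∈A , a∉B | b , b∈B , b∉C | c , c∈C , c∉A =
    claw-free (clique-adj (proj₁ A-max) v∈A a∈A (≢-sym a≢v))
              (clique-adj (proj₁ B-max) v∈B b∈B (≢-sym b≢v))
              (clique-adj (proj₁ C-max) v∈C c∈C (≢-sym c≢v))
              (λ { refl → a≢v (maximal-∩-subsingleton A-max B-max A≢B a∈A b∈B v∈A v∈B) })
              (λ { refl → a≢v (maximal-∩-subsingleton A-max C-max A≢C a∈A c∈C v∈A v∈C) })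
              (λ { refl → b≢v (maximal-∩-subsingleton B-max C-max B≢C b∈B c∈C v∈B v∈C) })
              (maximal-∩-no-edge A-max B-max A≢B v∈A v∈B a∈A b∈B a≢v b≢v)
              (maximal-∩-no-edge A-max C-max A≢C v∈A v∈C a∈A c∈C a≢v c≢v)
              (maximal-∩-no-edge B-max C-max B≢C v∈B v∈C b∈B c∈C b≢v c≢v)
    where
    a≢v : a ≢ v
    a≢v refl = a∉B v∈B
    b≢v : b ≢ v
    b≢v refl = b∉C v∈C
    c≢v : c ≢ v
    c≢v refl = c∉A v∈A

  module Closer {C₀ v₀ v₁} (C₀-max : IsMaximalClique G C₀) (v₀∈C₀ : v₀ ∈ C₀) (v₁∈C₀ : v₁ ∈ C₀)
                (v₀≢v₁ : v₀ ≢ v₁) where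
    open Distance isd
    open ≤-Reasoning

    Closer : Fin n → Set
    Closer y = d v₁ y < d v₀ y

    closer-v₁ : Closer v₁
    closer-v₁ rewrite d-diag v₁ = ≢⇒1≤d v₀≢v₁

    ¬closer-v₀ : ¬ Closer v₀
    ¬closer-v₀ rewrite d-diag v₀ = λ ()

    closer-adjacent : ∀ {y y'} → y ≢ v₀ → y ≢ v₁ → y' ≢ v₀ → y' ≢ v₁ → Adj G y y' →
                      Closer y → Closer y'
    closer-adjacent {y} {y'} y≢v₀ y≢v₁ y'≢v₀ y'≢v₁ yy' closer-y = ≰⇒> λ farther →
      <⇒≱ (four-point-inequality d-diag d-sym qec distinct) (begin
        d v₀ v₁ + d v₁ y + d y y' + d y' v₀
          ≤⟨ +-mono-≤ (+-mono-≤ (+-monoˡ-≤ (d v₁ y) (Adj⇒d≤1 v₀v₁)) (Adj⇒d≤1 yy'))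
                      (subst (_≤ d v₁ y') (d-sym v₀ y') farther) ⟩
        1 + d v₁ y + 1 + d v₁ y'
          ≡⟨ rearrange (d v₁ y) (d v₁ y') ⟩
        suc (d v₁ y) + d v₁ y' + 1
          ≤⟨ +-monoˡ-≤ 1 (+-monoˡ-≤ (d v₁ y') closer-y) ⟩
        d v₀ y + d v₁ y' + 1 ∎)
      where
      v₀v₁ = clique-adj (proj₁ C₀-max) v₀∈C₀ v₁∈C₀ v₀≢v₁
      distinct = distinct₄ v₀≢v₁ (≢-sym y≢v₀) (≢-sym y'≢v₀) (≢-sym y≢v₁) (≢-sym y'≢v₁) (Adj⇒≢ G yy')
      rearrange : ∀ a b → 1 + a + 1 + b ≡ suc a + b + 1
      rearrange = solve-∀

    v₀∉ : ∀ {C y} → IsMaximalClique G C → C₀ ≢ C → y ∈ C → Closer y → v₀ ∉ C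
    v₀∉ {C} {y} C-max C₀≢C y∈C closer-y v₀∈C =
      v₀≢v₁ (maximal-∩-subsingleton C₀-max C-max C₀≢C v₀∈C₀ v₀∈C v₁∈C₀ v₁∈C)
      where
      v₀y = clique-adj (proj₁ C-max) v₀∈C y∈C λ { refl → ¬closer-v₀ closer-y }
      v₁≡y : v₁ ≡ y
      v₁≡y = decidable-stable (v₁ ≟ y) λ v₁≢y →
        ℕₚ.<-irrefl refl (≤-<-trans (≢⇒1≤d v₁≢y) (<-≤-trans closer-y (Adj⇒d≤1 v₀y)))
      v₁∈C = subst (_∈ C) (sym v₁≡y) y∈C

    closer-step : ∀ {C y y'} → IsMaximalClique G C → C₀ ≢ C → y ∈ C → y' ∈ C → Closer y → Closer y'
    closer-step {C} {y} {y'} C-max C₀≢C y∈C y'∈C closer-y with y' ≟ v₁ | y ≟ y' | y ≟ v₁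
    ... | yes refl | _        | _        = closer-v₁
    ... | no  _    | yes refl | _        = closer-y
    ... | no y'≢v₁ | no  _    | yes refl = <-≤-trans (s≤s (Adj⇒d≤1 v₁y')) (≢∧¬Adj⇒2≤d v₀≢y' ¬v₀y')
      where
      v₀≢y' : v₀ ≢ y'
      v₀≢y' refl = v₀∉ C-max C₀≢C y∈C closer-y y'∈C
      v₁y'  = clique-adj (proj₁ C-max) y∈C y'∈C (≢-sym y'≢v₁)
      ¬v₀y' = maximal-∩-no-edge C₀-max C-max C₀≢C v₁∈C₀ y∈C v₀∈C₀ y'∈C v₀≢v₁ y'≢v₁
    ... | no y'≢v₁ | no y≢y'  | no y≢v₁  =
      closer-adjacent (λ { refl → ¬closer-v₀ closer-y }) y≢v₁
                      (λ { refl → v₀∉ C-max C₀≢C y∈C closer-y y'∈C }) y'≢v₁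
                      (clique-adj (proj₁ C-max) y∈C y'∈C y≢y') closer-y

    closer-along : ∀ {D Ds} → All (IsMaximalClique G) (D ∷ Ds) → All (C₀ ≢_) (D ∷ Ds) →
                   Linked ΓAdj (D ∷ Ds) → ∀ {y} → y ∈ D → Closer y →
                   ∀ {L} → last (D ∷ Ds) ≡ just L → ∀ {z} → z ∈ L → Closer z
    closer-along {Ds = []} (D-max ∷ []) (C₀≢D ∷ []) [-] y∈D closer-y refl z∈D =
      closer-step D-max C₀≢D y∈D z∈D closer-y
    closer-along {D} {D' ∷ _} (D-max ∷ maxs) (C₀≢D ∷ C₀≢s) ((_ , y' , y'∈D∩D') ∷ links) y∈D closer-y =
      closer-along maxs C₀≢s links y'∈D' (closer-step D-max C₀≢D y∈D y'∈D closer-y)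
      where
      y'∈D  = proj₁ (x∈p∩q⁻ D D' y'∈D∩D')
      y'∈D' = proj₂ (x∈p∩q⁻ D D' y'∈D∩D')

  no-Γ-cycle : ∀ Cs → ¬ IsCycle (IsMaximalClique G) ΓAdj Cs
  no-Γ-cycle []           ()
  no-Γ-cycle (_ ∷ [])     (s≤s () , _)
  no-Γ-cycle (_ ∷ _ ∷ []) (s≤s (s≤s ()) , _)
  no-Γ-cycle (C₀ ∷ C₁ ∷ C₂ ∷ Cs)
             (_ , C₀-max ∷ maxs@(C₁-max ∷ maxs') , (C₀≢ ∷ C₁≢ ∷ _) , ((_ , v₁ , v₁∈C₀∩C₁) ∷ links) , closing)
    with last-∷ C₂ Cs
  ... | L , last≡L with closing L last≡L
  ... | _ , v₀ , v₀∈L∩C₀ = ¬closer-v₀ (closer-along maxs C₀≢ links v₁∈C₁ closer-v₁ last≡L v₀∈L)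
    where
    v₀∈L  = proj₁ (x∈p∩q⁻ L C₀ v₀∈L∩C₀)
    v₀∈C₀ = proj₂ (x∈p∩q⁻ L C₀ v₀∈L∩C₀)
    v₁∈C₀ = proj₁ (x∈p∩q⁻ C₀ C₁ v₁∈C₀∩C₁)
    v₁∈C₁ = proj₂ (x∈p∩q⁻ C₀ C₁ v₁∈C₀∩C₁)
    v₀≢v₁ : v₀ ≢ v₁
    v₀≢v₁ v₀≡v₁ = maximal-∩₃-empty C₀-max C₁-max (All-last maxs' last≡L)
      (All.head C₀≢) (All-last (All.tail C₀≢) last≡L) (All-last C₁≢ last≡L)
      v₀∈C₀ (subst (_∈ C₁) (sym v₀≡v₁) v₁∈C₁) v₀∈L
    open Closer C₀-max v₀∈C₀ v₁∈C₀ v₀≢v₁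

proposition4p4 : ∀ (n : ℕ) (G : Graph n) (d : Fin n → Fin n → ℕ)
    → 2 ≤ n → Connected G → IsDistance G d → QECBelow d -½
    → IsTree (IsMaximalClique G) ΓAdj
proposition4p4 (suc n) G d (s≤s _) connected isd qec = (M , M-max) , Γ-connected , no-Γ-cycle
  where
  open Cliques G
  open MaximalCliques isd qec
  M = proj₁ (extend-to-maximal (⁅⁆-clique zero))
  M-max = proj₁ (proj₂ (extend-to-maximal (⁅⁆-clique zero)))
  Γ-connected : ∀ S T → IsMaximalClique G S → IsMaximalClique G T → WalkIn (IsMaximalClique G) ΓAdj S T
  Γ-connected S T S-max@(((s , s∈S) , _) , _) T-max@(((t , t∈T) , _) , _) =
    Γ-walk (proj₂ (connected s t)) S-max T-max s∈S t∈T
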